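{- If a Latin square $L$ of order $n \geq 5$ has a transversal, then every entry of $L$ belongs to some minimal $(n+1)$-cover of $L$.
   Context: A Latin square of order $n$ is an $n\times n$ array on $n$ symbols in which each symbol occurs once in each row and each column; its entries are the triples $(i,j,L_{ij})$. A line is the set of all entries in a given row, in a given column, or with a given symbol. A transversal is a set of $n$ entries meeting every line exactly once. A cover is a set of entries meeting every line; an $(n+1)$-cover is a cover of size $n+1$; a cover $\mathscr{C}$ is minimal if $\mathscr{C}\setminus\{\mathbf{e}\}$ is not a cover for all $\mathbf{e}\in\mathscr{C}$. -}

module Defs where

open import Data.Nat using (ℕ; suc)
open import Data.Fin using (Fin)
open import Data.Product using (_×_; _,_; proj₁; proj₂; ∃-syntax; Σ-syntax)
open import Data.List using (List; length)
open import Data.List.Membership.Propositional using (_∈_)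
open import Data.List.Relation.Unary.Unique.Propositional using (Unique)
open import Relation.Binary.PropositionalEquality using (_≡_; _≢_)
open import Relation.Nullary using (¬_)
open import Function.Definitions using (Injective)

-- A Latin square of order n on the symbol set Fin n, with rows and
-- columns indexed by Fin n: every symbol occurs once in each row and
-- each column (for an n×n array on n symbols, this is equivalent to
-- each row map and each column map being injective).
record LatinSquare (n : ℕ) : Set where
  field
    sym      : Fin n → Fin n → Fin n
    row-inj  : ∀ i → Injective _≡_ _≡_ (λ j → sym i j)
    col-inj  : ∀ j → Injective _≡_ _≡_ (λ i → sym i j)

open LatinSquare public

-- An entry (i , j , L i j) is identified by its cell (i , j).
Cell : ℕ → Set
Cell n = Fin n × Fin n

data Line (n : ℕ) : Set where
  row    : Fin n → Line n
  column : Fin n → Line n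
  symbol : Fin n → Line n

OnLine : ∀ {n} → LatinSquare n → Cell n → Line n → Set
OnLine L (i , j) (row r)    = i ≡ r
OnLine L (i , j) (column c) = j ≡ c
OnLine L (i , j) (symbol s) = sym L i j ≡ s

IsCoverP : ∀ {n} → LatinSquare n → (Cell n → Set) → Set
IsCoverP L S = ∀ ℓ → ∃[ e ] (S e × OnLine L e ℓ)

-- Finite sets of entries are duplicate-free lists of cells.
IsCover : ∀ {n} → LatinSquare n → List (Cell n) → Set
IsCover L C = IsCoverP L (λ e → e ∈ C)

IsTransversal : ∀ {n} → LatinSquare n → List (Cell n) → Set
IsTransversal {n} L T =
  Unique T × length T ≡ n ×
  (∀ ℓ → ∃[ e ] (e ∈ T × OnLine L e ℓ ×
                 (∀ e′ → e′ ∈ T → OnLine L e′ ℓ → e′ ≡ e)))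

HasTransversal : ∀ {n} → LatinSquare n → Set
HasTransversal L = ∃[ T ] IsTransversal L T

IsMinimalCover : ∀ {n} → LatinSquare n → List (Cell n) → Set
IsMinimalCover L C =
  IsCover L C × (∀ e → e ∈ C → ¬ IsCoverP L (λ x → x ∈ C × x ≢ e))

IsMinimalSuccCover : ∀ {n} → LatinSquare n → List (Cell n) → Set
IsMinimalSuccCover {n} L C = Unique C × length C ≡ suc n × IsMinimalCover L C

-- A transversal T is described row-wise: row r uses column τ r and
-- symbol σ r.  For rows a ≢ b, replace the entries of T in rows a, b by
-- (a , τ b), (b , w), (v , τ a), where (b , w) carries σ a and (v , τ a)
-- carries σ b.  This "swap cover" is a minimal (n+1)-cover unless the rows
-- a, b, v form a trade: (a , τ b), (b , τ v), (v , τ a) carry σ v, σ a,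
-- σ b.  Performing a trade turns T into another transversal.
--   * An entry (e , τ e) of T: swap two rows a, b ≢ e.  If they form a
--     trade, try fourth rows d in T and in the traded transversal; when all
--     these swaps fail, row a is forced, and two different choices of d
--     (possible as n ≥ 5) force incompatible entries.
--   * An entry (i , j) off T: swap row i with the row of T in column j; if
--     that fails, perform the trade, after which (i , j) is on a transversal.
module Submission where

open import Defs
open import Data.Nat as ℕ using (ℕ; _≥_; _<_)
import Data.Nat.Properties as ℕ
open import Data.Fin using (Fin; punchOut)
open import Data.Fin.Properties using (_≟_; any?; punchOut-injective; injective⇒≤)
open import Data.Product using (_×_; _,_; proj₁; proj₂; ∃-syntax)
open import Data.Sum using (_⊎_; inj₁; inj₂)
open import Data.List using (List; []; _∷_; length; tabulate; lookup)
open import Data.List.Properties using (length-tabulate)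
open import Data.List.Membership.Propositional using (_∈_; _∉_)
open import Data.List.Membership.Propositional.Properties using (∈-tabulate⁺; ∈-tabulate⁻)
import Data.List.Relation.Unary.Any as Any
open Any using (here; there; index)
open import Data.List.Relation.Unary.Any.Properties using (lookup-index)
import Data.List.Relation.Unary.All as All
open import Data.List.Relation.Unary.Unique.Propositional using (Unique; _∷_)
open import Data.List.Relation.Unary.Unique.Propositional.Properties using (tabulate⁺)
open import Data.Vec.Functional using (updateAt)
open import Data.Vec.Functional.Properties using (updateAt-updates; updateAt-minimal)
open import Relation.Nullary using (¬_; yes; no; contradiction)
open import Relation.Nullary.Decidable using (¬?; decidable-stable)
open import Relation.Binary.PropositionalEquality
  using (_≡_; _≢_; refl; cong; trans; subst; ≢-sym; module ≡-Reasoning)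
  renaming (sym to ≡-sym)

-- An injective endomap of Fin n is onto: otherwise punching out a missed
-- value would inject Fin n into Fin (n - 1).
injective⇒onto : ∀ {n} (f : Fin n → Fin n) → (∀ {x y} → f x ≡ f y → x ≡ y) →
                 ∀ y → ∃[ x ] f x ≡ y
injective⇒onto {ℕ.zero} f f-inj ()
injective⇒onto {ℕ.suc m} f f-inj y with any? (λ x → f x ≟ y)
... | yes hit = hit
... | no miss = contradiction (injective⇒≤ g-inj) ℕ.1+n≰n
  where
  y≢f : ∀ x → y ≢ f x
  y≢f x eq = miss (x , ≡-sym eq)
  g : Fin (ℕ.suc m) → Fin m
  g x = punchOut (y≢f x)
  g-inj : ∀ {x x′} → g x ≡ g x′ → x ≡ x′
  g-inj {x} {x′} eq = f-inj (punchOut-injective (y≢f x) (y≢f x′) eq)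

-- A list of fewer than n elements of Fin n misses some element: otherwise
-- the position of each element in the list would inject Fin n into a
-- smaller Fin.
fresh : ∀ {n} (xs : List (Fin n)) → length xs < n → ∃[ y ] y ∉ xs
fresh xs short with any? (λ y → ¬? (Any.any? (y ≟_) xs))
... | yes found = found
... | no none = contradiction (injective⇒≤ position-inj) (ℕ.<⇒≱ short)
  where
  everywhere : ∀ y → y ∈ xs
  everywhere y = decidable-stable (Any.any? (y ≟_) xs) (λ y∉xs → none (y , y∉xs))
  position-inj : ∀ {x y} → index (everywhere x) ≡ index (everywhere y) → x ≡ y
  position-inj {x} {y} eq =
    trans (lookup-index (everywhere x))
          (trans (cong (lookup xs) eq) (≡-sym (lookup-index (everywhere y))))

cycle : ∀ {n} → Fin n → Fin n → Fin n → Fin n → Fin n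
cycle x y z r with r ≟ x | r ≟ y | r ≟ z
... | yes _ | _     | _     = y
... | no _  | yes _ | _     = z
... | no _  | no _  | yes _ = x
... | no _  | no _  | no _  = r

position : ∀ {n} (x y z r : Fin n) → r ≡ x ⊎ r ≡ y ⊎ r ≡ z ⊎ (r ≢ x × r ≢ y × r ≢ z)
position x y z r with r ≟ x | r ≟ y | r ≟ z
... | yes r≡x | _       | _       = inj₁ r≡x
... | no _    | yes r≡y | _       = inj₂ (inj₁ r≡y)
... | no _    | no _    | yes r≡z = inj₂ (inj₂ (inj₁ r≡z))
... | no r≢x  | no r≢y  | no r≢z  = inj₂ (inj₂ (inj₂ (r≢x , r≢y , r≢z)))

cycle-fixes : ∀ {n} {x y z r : Fin n} → r ≢ x → r ≢ y → r ≢ z → cycle x y z r ≡ r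
cycle-fixes {x = x} {y} {z} {r} r≢x r≢y r≢z with r ≟ x | r ≟ y | r ≟ z
... | yes r≡x | _       | _       = contradiction r≡x r≢x
... | no _    | yes r≡y | _       = contradiction r≡y r≢y
... | no _    | no _    | yes r≡z = contradiction r≡z r≢z
... | no _    | no _    | no _    = refl

module _ {n} {x y z : Fin n} (y≢x : y ≢ x) (z≢x : z ≢ x) (z≢y : z ≢ y) where

  cycle-x : cycle x y z x ≡ y
  cycle-x with x ≟ x
  ... | yes _   = refl
  ... | no x≢x = contradiction refl x≢x

  cycle-y : cycle x y z y ≡ z
  cycle-y with y ≟ x | y ≟ y
  ... | yes y≡x | _       = contradiction y≡x y≢x
  ... | no _    | yes _   = refl
  ... | no _    | no y≢y = contradiction refl y≢y

  cycle-z : cycle x y z z ≡ x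
  cycle-z with z ≟ x | z ≟ y | z ≟ z
  ... | yes z≡x | _       | _      = contradiction z≡x z≢x
  ... | no _    | yes z≡y | _      = contradiction z≡y z≢y
  ... | no _    | no _    | yes _  = refl
  ... | no _    | no _    | no z≢z = contradiction refl z≢z

module _ {n} {x y z : Fin n} (y≢x : y ≢ x) (z≢x : z ≢ x) (z≢y : z ≢ y) where

  cycle-inverse : ∀ r → cycle x z y (cycle x y z r) ≡ r
  cycle-inverse r with position x y z r
  ... | inj₁ refl =
        trans (cong (cycle x z y) (cycle-x y≢x z≢x z≢y)) (cycle-z z≢x y≢x (≢-sym z≢y))
  ... | inj₂ (inj₁ refl) =
        trans (cong (cycle x z y) (cycle-y y≢x z≢x z≢y)) (cycle-y z≢x y≢x (≢-sym z≢y))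
  ... | inj₂ (inj₂ (inj₁ refl)) =
        trans (cong (cycle x z y) (cycle-z y≢x z≢x z≢y)) (cycle-x z≢x y≢x (≢-sym z≢y))
  ... | inj₂ (inj₂ (inj₂ (r≢x , r≢y , r≢z))) =
        trans (cong (cycle x z y) (cycle-fixes r≢x r≢y r≢z)) (cycle-fixes r≢x r≢z r≢y)

  cycle-injective : ∀ {r s} → cycle x y z r ≡ cycle x y z s → r ≡ s
  cycle-injective {r} {s} eq =
    trans (≡-sym (cycle-inverse r)) (trans (cong (cycle x z y) eq) (cycle-inverse s))

graph : ∀ {n} → (Fin n → Fin n) → List (Cell n)
graph κ = tabulate (λ r → r , κ r)

∈graph⁻ : ∀ {n} {κ : Fin n → Fin n} {i j} → (i , j) ∈ graph κ → j ≡ κ i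
∈graph⁻ p with ∈-tabulate⁻ p
... | _ , refl = refl

graph+1-unique : ∀ {n} (κ : Fin n → Fin n) x → x ∉ graph κ → Unique (x ∷ graph κ)
graph+1-unique κ x x∉ =
  All.tabulate (λ y∈ x≡y → x∉ (subst (_∈ graph κ) (≡-sym x≡y) y∈)) ∷ tabulate⁺ (cong proj₁)

graph+1-length : ∀ {n} (κ : Fin n → Fin n) x → length (x ∷ graph κ) ≡ ℕ.suc n
graph+1-length κ x = cong ℕ.suc (length-tabulate _)

module _ {n : ℕ} (L : LatinSquare n) where

  columnWith : ∀ i s → ∃[ j ] sym L i j ≡ s
  columnWith i = injective⇒onto (sym L i) (row-inj L i)

  rowWith : ∀ j s → ∃[ i ] sym L i j ≡ s
  rowWith j = injective⇒onto (λ i → sym L i j) (col-inj L j)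

  InMinimalCover : Cell n → Set
  InMinimalCover e = ∃[ C ] (IsMinimalSuccCover L C × e ∈ C)

  privateLine⇒essential : ∀ C x ℓ → (∀ y → y ∈ C → OnLine L y ℓ → y ≡ x) →
                          ¬ IsCoverP L (λ y → y ∈ C × y ≢ x)
  privateLine⇒essential C x ℓ only cover with cover ℓ
  ... | y , (y∈C , y≢x) , y∈ℓ = y≢x (only y y∈C y∈ℓ)

  record RowTransversal : Set where
    field
      τ     : Fin n → Fin n
      τ-inj : ∀ {x y} → τ x ≡ τ y → x ≡ y
      σ-inj : ∀ {x y} → sym L x (τ x) ≡ sym L y (τ y) → x ≡ y

    σ : Fin n → Fin n
    σ r = sym L r (τ r)

    rowAt : ∀ c → ∃[ r ] τ r ≡ c
    rowAt = injective⇒onto τ τ-inj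

    rowOfSymbol : ∀ s → ∃[ r ] σ r ≡ s
    rowOfSymbol = injective⇒onto σ σ-inj

  -- A transversal given as a list of entries is a row transversal: two of
  -- its entries on a common line coincide.
  fromIsTransversal : ∀ T → IsTransversal L T → RowTransversal
  fromIsTransversal T (_ , _ , unique) = record
    { τ     = τ
    ; τ-inj = λ {x} {y} eq → sameLine (column (τ y)) eq refl
    ; σ-inj = λ {x} {y} eq → sameLine (symbol (sym L y (τ y))) eq refl
    }
    where
    τ : Fin n → Fin n
    τ r = proj₂ (proj₁ (unique (row r)))
    inT : ∀ r → (r , τ r) ∈ T
    inT r with unique (row r)
    ... | _ , e∈T , refl , _ = e∈T
    sameLine : ∀ ℓ {x y} → OnLine L (x , τ x) ℓ → OnLine L (y , τ y) ℓ → x ≡ y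
    sameLine ℓ {x} {y} x∈ℓ y∈ℓ =
      let _ , _ , _ , only = unique ℓ
      in cong proj₁ (trans (only _ (inT x) x∈ℓ) (≡-sym (only _ (inT y) y∈ℓ)))

module _ {n : ℕ} {L : LatinSquare n} (T : RowTransversal L) where
  open RowTransversal T

  record SwapCover (a b : Fin n) : Set where
    field
      cover   : List (Cell n)
      minimal : IsMinimalSuccCover L cover
      has-ab  : (a , τ b) ∈ cover
      has-T   : ∀ r → r ≢ a → r ≢ b → (r , τ r) ∈ cover

  -- Replace the entries of T in rows a, b by (a , τ b), (b , w) and
  -- (v , τ a), where w and v are chosen so that (b , w) carries σ a and
  -- (v , τ a) carries σ b.  The result is a minimal (n+1)-cover unless
  -- (v , τ v) ends up with neither a private column nor a private symbol.
  module Swap (a b : Fin n) (a≢b : a ≢ b) (w v : Fin n)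
              (hw : sym L b w ≡ σ a) (hv : sym L v (τ a) ≡ σ b)
              (good : ¬ (w ≡ τ v × sym L v w ≡ sym L a (τ b))) where

    κ : Fin n → Fin n
    κ = updateAt (updateAt τ b (λ _ → w)) a (λ _ → τ b)

    κ-a : κ a ≡ τ b
    κ-a = updateAt-updates a _

    κ-b : κ b ≡ w
    κ-b = trans (updateAt-minimal b a _ (≢-sym a≢b)) (updateAt-updates b τ)

    κ-T : ∀ {r} → r ≢ a → r ≢ b → κ r ≡ τ r
    κ-T {r} r≢a r≢b = trans (updateAt-minimal r a _ r≢a) (updateAt-minimal r b τ r≢b)

    rowKind : ∀ r → r ≡ a ⊎ r ≡ b ⊎ (r ≢ a × r ≢ b)
    rowKind r with r ≟ a | r ≟ b
    ... | yes r≡a | _       = inj₁ r≡a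
    ... | no _    | yes r≡b = inj₂ (inj₁ r≡b)
    ... | no r≢a  | no r≢b  = inj₂ (inj₂ (r≢a , r≢b))

    v≢a : v ≢ a
    v≢a refl = a≢b (σ-inj hv)

    v≢b : v ≢ b
    v≢b refl = a≢b (τ-inj (row-inj L v hv))

    extra : Cell n
    extra = v , τ a

    C : List (Cell n)
    C = extra ∷ graph κ

    inGraph : ∀ {r j} → κ r ≡ j → (r , j) ∈ C
    inGraph {r} refl = there (∈-tabulate⁺ r)

    extra∉graph : extra ∉ graph κ
    extra∉graph p = v≢a (≡-sym (τ-inj (trans (∈graph⁻ p) (κ-T v≢a v≢b))))

    covers : IsCover L C
    covers (row r) = (r , κ r) , inGraph refl , refl
    covers (column c) with rowAt c
    ... | r , refl with rowKind r
    ...   | inj₁ refl              = extra , here refl , refl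
    ...   | inj₂ (inj₁ refl)       = (a , τ b) , inGraph κ-a , refl
    ...   | inj₂ (inj₂ (r≢a , r≢b)) = (r , τ r) , inGraph (κ-T r≢a r≢b) , refl
    covers (symbol s) with rowOfSymbol s
    ... | r , refl with rowKind r
    ...   | inj₁ refl              = (b , w) , inGraph κ-b , hw
    ...   | inj₂ (inj₁ refl)       = extra , here refl , hv
    ...   | inj₂ (inj₂ (r≢a , r≢b)) = (r , τ r) , inGraph (κ-T r≢a r≢b) , refl

    onlyExtra : ∀ y → y ∈ C → OnLine L y (symbol (σ b)) → y ≡ extra
    onlyExtra _ (here refl) _ = refl
    onlyExtra _ (there p) on with ∈-tabulate⁻ p
    ... | i , refl with rowKind i
    ...   | inj₁ refl =
            contradiction (col-inj L (τ b) (trans (cong (sym L a) (≡-sym κ-a)) on)) a≢b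
    ...   | inj₂ (inj₁ refl) =
            contradiction (σ-inj (trans (≡-sym hw) (trans (cong (sym L b) (≡-sym κ-b)) on))) a≢b
    ...   | inj₂ (inj₂ (i≢a , i≢b)) =
            contradiction (σ-inj (trans (cong (sym L i) (≡-sym (κ-T i≢a i≢b))) on)) i≢b

    onlyInRow : ∀ i → i ≢ v → ∀ y → y ∈ C → OnLine L y (row i) → y ≡ (i , κ i)
    onlyInRow i i≢v _ (here refl) v≡i = contradiction (≡-sym v≡i) i≢v
    onlyInRow i i≢v _ (there p) refl with ∈-tabulate⁻ p
    ... | _ , refl = refl

    onlyInColumn : w ≢ τ v → ∀ y → y ∈ C → OnLine L y (column (τ v)) → y ≡ (v , κ v)
    onlyInColumn w≢τv _ (here refl) on = contradiction (τ-inj on) (≢-sym v≢a)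
    onlyInColumn w≢τv _ (there p) on with ∈-tabulate⁻ p
    ... | i , refl with rowKind i
    ...   | inj₁ refl = contradiction (τ-inj (trans (≡-sym κ-a) on)) (≢-sym v≢b)
    ...   | inj₂ (inj₁ refl) = contradiction (trans (≡-sym κ-b) on) w≢τv
    ...   | inj₂ (inj₂ (i≢a , i≢b)) =
            cong (λ r → r , κ r) (τ-inj (trans (≡-sym (κ-T i≢a i≢b)) on))

    onlyOfSymbol : sym L a (τ b) ≢ σ v → ∀ y → y ∈ C → OnLine L y (symbol (σ v)) → y ≡ (v , κ v)
    onlyOfSymbol ≢σv _ (here refl) on =
      contradiction (σ-inj (trans (≡-sym hv) on)) (≢-sym v≢b)
    onlyOfSymbol ≢σv _ (there p) on with ∈-tabulate⁻ p
    ... | i , refl with rowKind i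
    ...   | inj₁ refl = contradiction (trans (cong (sym L a) (≡-sym κ-a)) on) ≢σv
    ...   | inj₂ (inj₁ refl) =
            contradiction (σ-inj (trans (≡-sym hw) (trans (cong (sym L b) (≡-sym κ-b)) on))) (≢-sym v≢a)
    ...   | inj₂ (inj₂ (i≢a , i≢b)) =
            cong (λ r → r , κ r) (σ-inj (trans (cong (sym L i) (≡-sym (κ-T i≢a i≢b))) on))

    -- Every entry of C has a private line.
    essential : ∀ x → x ∈ C → ¬ IsCoverP L (λ y → y ∈ C × y ≢ x)
    essential _ (here refl) = privateLine⇒essential L C extra (symbol (σ b)) onlyExtra
    essential _ (there p) with ∈-tabulate⁻ p
    ... | i , refl with i ≟ v
    ...   | no i≢v = privateLine⇒essential L C _ (row i) (onlyInRow i i≢v)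
    ...   | yes refl with w ≟ τ i
    ...     | no w≢τv = privateLine⇒essential L C _ (column (τ i)) (onlyInColumn w≢τv)
    ...     | yes w≡τv with sym L a (τ b) ≟ σ i
    ...       | no ≢σv = privateLine⇒essential L C _ (symbol (σ i)) (onlyOfSymbol ≢σv)
    ...       | yes ≡σv = contradiction (w≡τv , trans (cong (sym L i) w≡τv) (≡-sym ≡σv)) good

    swapCover : SwapCover a b
    swapCover = record
      { cover   = C
      ; minimal = graph+1-unique κ extra extra∉graph , graph+1-length κ extra , covers , essential
      ; has-ab  = inGraph κ-a
      ; has-T   = λ r r≢a r≢b → inGraph (κ-T r≢a r≢b)
      }

  swapKeeps : ∀ {a b e} → SwapCover a b → e ≢ a → e ≢ b → InMinimalCover L (e , τ e)
  swapKeeps {e = e} S e≢a e≢b = cover , minimal , has-T e e≢a e≢b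
    where open SwapCover S

  record Trade (x y z : Fin n) : Set where
    field
      at-x : sym L x (τ y) ≡ σ z
      at-y : sym L y (τ z) ≡ σ x
      at-z : sym L z (τ x) ≡ σ y

  trade-distinct : ∀ {x y z} → x ≢ y → Trade x y z → z ≢ x × z ≢ y
  trade-distinct x≢y t =
    (λ { refl → x≢y (σ-inj (Trade.at-z t)) }) , (λ { refl → x≢y (σ-inj (≡-sym (Trade.at-y t))) })

  swapOrTrade : ∀ a b → a ≢ b → SwapCover a b ⊎ ∃[ c ] Trade a b c
  swapOrTrade a b a≢b with columnWith L b (σ a) | rowWith L (τ a) (σ b)
  ... | w , hw | v , hv with w ≟ τ v | sym L v w ≟ sym L a (τ b)
  ... | yes refl | yes same =
        inj₂ (v , record { at-x = ≡-sym same ; at-y = hw ; at-z = hv })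
  ... | no w≢τv | _ =
        inj₁ (Swap.swapCover a b a≢b w v hw hv (λ { (w≡τv , _) → w≢τv w≡τv }))
  ... | yes _ | no differ =
        inj₁ (Swap.swapCover a b a≢b w v hw hv (λ { (_ , same) → differ same }))

  reroute : (π ρ : Fin n → Fin n) →
            (∀ {x y} → π x ≡ π y → x ≡ y) → (∀ {x y} → ρ x ≡ ρ y → x ≡ y) →
            (∀ r → sym L r (τ (π r)) ≡ σ (ρ r)) → RowTransversal L
  reroute π ρ π-inj ρ-inj symbols = record
    { τ     = λ r → τ (π r)
    ; τ-inj = λ eq → π-inj (τ-inj eq)
    ; σ-inj = λ {x} {y} eq → ρ-inj (σ-inj (trans (≡-sym (symbols x)) (trans eq (symbols y))))
    }

-- This gives a transversal T′ that agrees with T outside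
-- the three rows; it is the tool for escaping a trade.
module Traded {n : ℕ} {L : LatinSquare n} (T : RowTransversal L)
              {a b c : Fin n} (b≢a : b ≢ a) (c≢a : c ≢ a) (c≢b : c ≢ b)
              (t : Trade T a b c) where
  open RowTransversal T
  open Trade

  b≢c : b ≢ c
  b≢c = ≢-sym c≢b

  π ρ : Fin n → Fin n
  π = cycle a b c
  ρ = cycle a c b

  symbols : ∀ r → sym L r (τ (π r)) ≡ σ (ρ r)
  symbols r with position a b c r
  ... | inj₁ refl
      rewrite cycle-x b≢a c≢a c≢b | cycle-x c≢a b≢a b≢c = at-x t
  ... | inj₂ (inj₁ refl)
      rewrite cycle-y b≢a c≢a c≢b | cycle-z c≢a b≢a b≢c = at-y t
  ... | inj₂ (inj₂ (inj₁ refl))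
      rewrite cycle-z b≢a c≢a c≢b | cycle-y c≢a b≢a b≢c = at-z t
  ... | inj₂ (inj₂ (inj₂ (r≢a , r≢b , r≢c)))
      rewrite cycle-fixes r≢a r≢b r≢c | cycle-fixes r≢a r≢c r≢b = refl

  T′ : RowTransversal L
  T′ = reroute T π ρ (cycle-injective b≢a c≢a c≢b) (cycle-injective c≢a b≢a b≢c) symbols

  -- Comparing them forces the trade of T′ to be (a,d,c), and
  -- then row a holds σ b in column τ d and σ d in column τ c.
  forcedEntries : ∀ {d z₁ z₂ z₃ z} → d ≢ a → d ≢ b → d ≢ c →
                  Trade T a d z₁ → Trade T b d z₂ → Trade T c d z₃ → Trade T′ a d z →
                  sym L a (τ d) ≡ σ b × sym L a (τ c) ≡ σ d
  forcedEntries {d} {z₁} {z₂} {z₃} {z} d≢a d≢b d≢c t₁ t₂ t₃ t′ = byPosition (position a b c z)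
    where
    open ≡-Reasoning

    πa : π a ≡ b
    πa = cycle-x b≢a c≢a c≢b

    πd : π d ≡ d
    πd = cycle-fixes d≢a d≢b d≢c

    ρz≡z₁ : ρ z ≡ z₁
    ρz≡z₁ = σ-inj (begin
      σ (ρ z)            ≡⟨ ≡-sym (symbols z) ⟩
      sym L z (τ (π z))  ≡⟨ ≡-sym (at-x t′) ⟩
      sym L a (τ (π d))  ≡⟨ cong (λ k → sym L a (τ k)) πd ⟩
      sym L a (τ d)      ≡⟨ at-x t₁ ⟩
      σ z₁               ∎)

    z≡z₂ : z ≡ z₂
    z≡z₂ = col-inj L (τ b) (begin
      sym L z (τ b)      ≡⟨ cong (λ k → sym L z (τ k)) (≡-sym πa) ⟩
      sym L z (τ (π a))  ≡⟨ at-z t′ ⟩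
      sym L d (τ (π d))  ≡⟨ cong (λ k → sym L d (τ k)) πd ⟩
      σ d                ≡⟨ ≡-sym (at-z t₂) ⟩
      sym L z₂ (τ b)     ∎)

    πz≡z₃ : π z ≡ z₃
    πz≡z₃ = τ-inj (row-inj L d (begin
      sym L d (τ (π z))  ≡⟨ at-y t′ ⟩
      sym L a (τ (π a))  ≡⟨ cong (λ k → sym L a (τ k)) πa ⟩
      sym L a (τ b)      ≡⟨ at-x t ⟩
      σ c                ≡⟨ ≡-sym (at-y t₃) ⟩
      sym L d (τ z₃)     ∎))

    tradeAD : ∀ {k} → ρ z ≡ k → Trade T a d k
    tradeAD eq = subst (Trade T a d) (trans (≡-sym ρz≡z₁) eq) t₁

    tradeBD : ∀ {k} → z ≡ k → Trade T b d k
    tradeBD eq = subst (Trade T b d) (trans (≡-sym z≡z₂) eq) t₂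

    tradeCD : ∀ {k} → π z ≡ k → Trade T c d k
    tradeCD eq = subst (Trade T c d) (trans (≡-sym πz≡z₃) eq) t₃

    byPosition : z ≡ a ⊎ z ≡ b ⊎ z ≡ c ⊎ (z ≢ a × z ≢ b × z ≢ c) →
                 sym L a (τ d) ≡ σ b × sym L a (τ c) ≡ σ d
    -- z = a: the trade (a,d,c) puts σ d at (c , τ a), where t puts σ b
    byPosition (inj₁ z≡a) =
      contradiction (σ-inj (trans (≡-sym (at-z t))
                                  (at-z (tradeAD (trans (cong ρ z≡a) (cycle-x c≢a b≢a b≢c))))))
                    (≢-sym d≢b)
    -- z = b: (b,d,b) is not a trade
    byPosition (inj₂ (inj₁ z≡b)) =
      contradiction refl (proj₁ (trade-distinct T (≢-sym d≢b) (tradeBD z≡b)))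
    -- z = c: the trades (a,d,b) and (c,d,a) give the claim
    byPosition (inj₂ (inj₂ (inj₁ z≡c))) =
      at-x (tradeAD (trans (cong ρ z≡c) (cycle-y c≢a b≢a b≢c))) ,
      at-z (tradeCD (trans (cong π z≡c) (cycle-z b≢a c≢a c≢b)))
    -- z outside: the trades (a,d,z) and (b,d,z) put σ z twice in column τ d
    byPosition (inj₂ (inj₂ (inj₂ (z≢a , z≢b , z≢c)))) =
      contradiction (col-inj L (τ d) (trans (at-x (tradeAD (cycle-fixes z≢a z≢c z≢b)))
                                            (≡-sym (at-x (tradeBD refl)))))
                    (≢-sym b≢a)

  -- Let e lie outside the trade and d outside {a, b, c, e}.  Swapping d with
  -- a, b or c in T, or with a in T′, keeps (e , τ e); if all four swaps fail,
  -- row a is forced as in forcedEntries.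
  fourthRow : ∀ {e d} → e ∉ a ∷ b ∷ c ∷ [] → d ∉ a ∷ b ∷ c ∷ e ∷ [] →
              InMinimalCover L (e , τ e) ⊎ (sym L a (τ d) ≡ σ b × sym L a (τ c) ≡ σ d)
  fourthRow {e} {d} e∉ d∉ =
    outcome (swapOrTrade T a d (≢-sym d≢a)) (swapOrTrade T b d (≢-sym d≢b))
            (swapOrTrade T c d (≢-sym d≢c)) (swapOrTrade T′ a d (≢-sym d≢a))
    where
    e≢a : e ≢ a
    e≢a e≡a = e∉ (here e≡a)
    e≢b : e ≢ b
    e≢b e≡b = e∉ (there (here e≡b))
    e≢c : e ≢ c
    e≢c e≡c = e∉ (there (there (here e≡c)))
    d≢a : d ≢ a
    d≢a d≡a = d∉ (here d≡a)
    d≢b : d ≢ b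
    d≢b d≡b = d∉ (there (here d≡b))
    d≢c : d ≢ c
    d≢c d≡c = d∉ (there (there (here d≡c)))
    e≢d : e ≢ d
    e≢d e≡d = d∉ (there (there (there (here (≡-sym e≡d)))))

    outcome : SwapCover T a d ⊎ ∃[ z ] Trade T a d z →
              SwapCover T b d ⊎ ∃[ z ] Trade T b d z →
              SwapCover T c d ⊎ ∃[ z ] Trade T c d z →
              SwapCover T′ a d ⊎ ∃[ z ] Trade T′ a d z →
              InMinimalCover L (e , τ e) ⊎ (sym L a (τ d) ≡ σ b × sym L a (τ c) ≡ σ d)
    outcome (inj₁ S) _ _ _ = inj₁ (swapKeeps T S e≢a e≢d)
    outcome _ (inj₁ S) _ _ = inj₁ (swapKeeps T S e≢b e≢d)
    outcome _ _ (inj₁ S) _ = inj₁ (swapKeeps T S e≢c e≢d)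
    outcome _ _ _ (inj₁ S) =
      inj₁ (subst (λ k → InMinimalCover L (e , τ k)) (cycle-fixes e≢a e≢b e≢c)
                  (swapKeeps T′ S e≢a e≢d))
    outcome (inj₂ (_ , t₁)) (inj₂ (_ , t₂)) (inj₂ (_ , t₃)) (inj₂ (_ , t′)) =
      inj₂ (forcedEntries d≢a d≢b d≢c t₁ t₂ t₃ t′)

  anotherFourthRow : ∀ {e d d′} → e ∉ a ∷ b ∷ c ∷ [] → d ≢ e → sym L a (τ d) ≡ σ b →
                     σ d′ ≡ sym L a (τ e) → d′ ∉ a ∷ b ∷ c ∷ e ∷ []
  anotherFourthRow {e} {d} {d′} e∉ d≢e ad≡σb σd′≡ae = excluded
    where
    σ-at : ∀ {k} → d′ ≡ k → σ k ≡ sym L a (τ e)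
    σ-at d′≡k = subst (λ k → σ k ≡ sym L a (τ e)) d′≡k σd′≡ae

    inRowA : ∀ {k} → sym L a (τ k) ≡ sym L a (τ e) → k ≡ e
    inRowA eq = τ-inj (row-inj L a eq)

    excluded : d′ ∉ a ∷ b ∷ c ∷ e ∷ []
    excluded (here d′≡a) = e∉ (here (≡-sym (inRowA (σ-at d′≡a))))
    excluded (there (here d′≡b)) = d≢e (inRowA (trans ad≡σb (σ-at d′≡b)))
    excluded (there (there (here d′≡c))) =
      e∉ (there (here (≡-sym (inRowA (trans (at-x t) (σ-at d′≡c))))))
    excluded (there (there (there (here d′≡e)))) = e∉ (here (col-inj L (τ e) (σ-at d′≡e)))

  -- For n ≥ 5, every entry (e , τ e) with e outside the trade lies in a
  -- minimal (n+1)-cover: the forced entries of two different fourth rows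
  -- d and d′ are incompatible.
  outsideTrade : 4 < n → ∀ {e} → e ∉ a ∷ b ∷ c ∷ [] → InMinimalCover L (e , τ e)
  outsideTrade 4<n {e} e∉ with fresh (a ∷ b ∷ c ∷ e ∷ []) 4<n
  ... | d , d∉ with fourthRow e∉ d∉
  ...   | inj₁ covered = covered
  ...   | inj₂ (ad≡σb , ac≡σd) with rowOfSymbol (sym L a (τ e))
  ...     | d′ , σd′≡ae
            with fourthRow e∉ (anotherFourthRow e∉ (λ d≡e → d∉ (there (there (there (here d≡e)))))
                                                ad≡σb σd′≡ae)
  ...       | inj₁ covered = covered
  ...       | inj₂ (ad′≡σb , _) = contradiction (there (there (here (≡-sym c≡e)))) e∉
    where
    d′≡d : d′ ≡ d
    d′≡d = τ-inj (row-inj L a (trans ad′≡σb (≡-sym ad≡σb)))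
    c≡e : c ≡ e
    c≡e = τ-inj (row-inj L a (trans ac≡σd (trans (cong σ (≡-sym d′≡d)) σd′≡ae)))

module _ {n : ℕ} {L : LatinSquare n} (T : RowTransversal L) where
  open RowTransversal T

  -- Swapping rows a and b, where a ≢ e and b avoids a, e and the row b₀ of
  -- T whose column holds σ e in row a, either keeps (e , τ e) or yields a
  -- trade (a, b, c) with c ≢ e, which outsideTrade escapes.
  swapAvoiding : 4 < n → ∀ {e a b b₀} → a ∉ e ∷ [] → b ∉ a ∷ e ∷ b₀ ∷ [] →
                 sym L a (τ b₀) ≡ σ e → InMinimalCover L (e , τ e)
  swapAvoiding 4<n {e} {a} {b} {b₀} a∉ b∉ a-has-σe = outcome (swapOrTrade T a b a≢b)
    where
    a≢b : a ≢ b
    a≢b a≡b = b∉ (here (≡-sym a≡b))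
    e≢a : e ≢ a
    e≢a e≡a = a∉ (here (≡-sym e≡a))
    e≢b : e ≢ b
    e≢b e≡b = b∉ (there (here (≡-sym e≡b)))

    -- e = c would put σ e at (a , τ b), but it sits at (a , τ b₀)
    avoids : ∀ {c} → Trade T a b c → e ∉ a ∷ b ∷ c ∷ []
    avoids t (here e≡a) = e≢a e≡a
    avoids t (there (here e≡b)) = e≢b e≡b
    avoids t (there (there (here e≡c))) = b∉ (there (there (here (τ-inj (row-inj L a
      (trans (Trade.at-x t) (trans (cong σ (≡-sym e≡c)) (≡-sym a-has-σe))))))))

    outcome : SwapCover T a b ⊎ ∃[ c ] Trade T a b c → InMinimalCover L (e , τ e)
    outcome (inj₁ S) = swapKeeps T S e≢a e≢b
    outcome (inj₂ (c , t)) =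
      Traded.outsideTrade T (≢-sym a≢b) (proj₁ (trade-distinct T a≢b t))
                          (proj₂ (trade-distinct T a≢b t)) t 4<n (avoids t)

  onTransversal : 4 < n → ∀ e → InMinimalCover L (e , τ e)
  onTransversal 4<n e with fresh (e ∷ []) (ℕ.≤-trans (ℕ.s≤s (ℕ.s≤s ℕ.z≤n)) 4<n)
  ... | a , a∉ with columnWith L a (σ e)
  ...   | j , a-has-σe with rowAt j
  ...     | b₀ , refl with fresh (a ∷ e ∷ b₀ ∷ []) (ℕ.<-trans (ℕ.n<1+n 3) 4<n)
  ...       | b , b∉ = swapAvoiding 4<n a∉ b∉ a-has-σe

module _ {n : ℕ} {L : LatinSquare n} (T : RowTransversal L) where
  open RowTransversal T

  everyEntry : 4 < n → ∀ i j → InMinimalCover L (i , j)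
  everyEntry 4<n i j with τ i ≟ j
  ... | yes refl = onTransversal T 4<n i
  ... | no τi≢j with rowAt j
  ...   | b , refl with swapOrTrade T i b (λ i≡b → τi≢j (cong τ i≡b))
  ...     | inj₁ S = SwapCover.cover S , SwapCover.minimal S , SwapCover.has-ab S
  ...     | inj₂ (c , t) =
              subst (λ k → InMinimalCover L (i , τ k)) (cycle-x b≢i c≢i c≢b)
                    (onTransversal (Traded.T′ T b≢i c≢i c≢b t) 4<n i)
    where
    b≢i : b ≢ i
    b≢i b≡i = τi≢j (cong τ (≡-sym b≡i))
    c≢i : c ≢ i
    c≢i = proj₁ (trade-distinct T (≢-sym b≢i) t)
    c≢b : c ≢ b
    c≢b = proj₂ (trade-distinct T (≢-sym b≢i) t)

theorem2p10 : (n : ℕ) → n ≥ 5 → (L : LatinSquare n) → HasTransversal L →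
                ∀ (e : Cell n) → ∃[ C ] (IsMinimalSuccCover L C × e ∈ C)
theorem2p10 n n≥5 L (T , isT) (i , j) = everyEntry (fromIsTransversal L T isT) n≥5 i j
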